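{- Let $n\geqslant1$, $\lambda\in\operatorname{Hk}_n$, and let $c\in\mathfrak{S}_{n+1}$ be a Coxeter element. Then for every filling $f$ of $\lambda$ and every $k\in\{1,\dots,n\}$, $$\sum_{\varepsilon=1}^{\delta_k}\mathcal{RSK}_{\lambda,c}(f)(\langle k,\varepsilon\rangle)=\sum_{b\in\square_k(\lambda)}f(b).$$
   Context: Partitions and fillings: $\operatorname{Fer}(\lambda)=\{(i,j)\in\mathbb{Z}_{>0}^2:i\leqslant\ell(\lambda),j\leqslant\lambda_i\}$, $\lambda'$ conjugate; $\operatorname{Hk}_n$ is the set of $\lambda$ with $\lambda_1+\ell(\lambda)-1=n$; a filling is a map $\operatorname{Fer}(\lambda)\to\mathbb{N}$. For $k\in\{1,\dots,n\}$: $D_k(\lambda)=\{(i,j)\in\operatorname{Fer}(\lambda):\lambda_1+i-j=k\}$, $\delta_k=\max\{\min(i,j):(i,j)\in D_k(\lambda)\}$, the box $(i,j)\in D_k(\lambda)$ has diagonal coordinates $\langle k,\delta\rangle$, $\delta=\delta_k-\min(i,j)+1$; $\square_k(\lambda)$ is the set of boxes $(i',j')\in\operatorname{Fer}(\lambda)$ such that $i'\leqslant i$, $j'\leqslant j$ for some $(i,j)\in D_k(\lambda)$. Labels: $\ell_i=\lambda_1+i-\lambda_i$, $r_j=\lambda_1-j+1+\lambda'_j$; $(i,j)\in\operatorname{Fer}(\lambda)$ iff $\ell_i<r_j$. Coxeter elements: with $s_i=(i,i+1)$, a Coxeter element of $\mathfrak{S}_{n+1}$ is $s_{\sigma(1)}\cdots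 s_{\sigma(n)}$ for a permutation $\sigma$ of $\{1,\dots,n\}$. Greene–Kleitman invariant: for a finite directed graph $G$ and $g$ from vertices to $\mathbb{N}$, paths are sequences $(v_0,\dots,v_t)$, $t\geqslant0$, with arrows $v_s\to v_{s+1}$; $M_0=0$, $M_m$ is the maximum over $m$-tuples of paths of the sum of $g$ over the union of their supports; $\operatorname{GK}_G(g)=(M_m-M_{m-1})_{m\geqslant1}$. $\mathcal{RSK}_{\lambda,c}$: $\operatorname{AR}(c)$ is the directed graph on pairs $(i,j)$, $1\leqslant i<j\leqslant n+1$, with arrows $(i,j)\to(i,c(j))$ if $i<c(j)$ and $(i,j)\to(c(i),j)$ if $c(i)<j$; $\operatorname{AR}^{[k]}(c)$ is the full subgraph on $(i,j)$ with $i\leqslant k<j$. For a filling $f$ let $g(\ell_i,r_j)=f(i,j)$ for $(i,j)\in\operatorname{Fer}(\lambda)$, $g=0$ elsewhere; $\mathcal{RSK}_{\lambda,c}(f)(\langle k,\delta\rangle)$ is the $\delta$-th entry of $\operatorname{GK}_{\operatorname{AR}^{[k]}(c)}(g|_{\operatorname{AR}^{[k]}(c)})$. -}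

module Defs where

open import Data.Nat using (ℕ; zero; suc; _+_; _∸_; _≤_; _<_; _⊔_; _⊓_; _≡ᵇ_; _≤ᵇ_)
open import Data.Nat.Properties using (_≟_)
open import Data.Bool using (Bool; true; false; if_then_else_; _∧_)
open import Data.List using (List; []; _∷_; length; map; concat; concatMap; foldr; filter; deduplicate; applyUpTo)
open import Data.Nat.ListAction using (sum)
open import Data.Bool.ListAction using (any)
open import Data.List.Relation.Unary.All using (All)
open import Data.List.Relation.Unary.Linked using (Linked)
open import Data.Vec using (Vec; toList)
import Data.Vec.Relation.Unary.All as VA
open import Data.Product using (_×_; _,_; Σ; ∃)
open import Data.Product.Properties using (≡-dec)
open import Data.Sum using (_⊎_)
open import Function using (id; _∘_)
open import Relation.Binary.PropositionalEquality using (_≡_)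

IsPartition : List ℕ → Set
IsPartition la = Linked _≥'_ la × All (λ x → 0 < x) la
  where _≥'_ : ℕ → ℕ → Set
        a ≥' b = b ≤ a

-- λ_i (1-indexed), 0 beyond the length
part : List ℕ → ℕ → ℕ
part []       _             = 0
part (x ∷ xs) zero          = 0
part (x ∷ xs) (suc zero)    = x
part (x ∷ xs) (suc (suc i)) = part xs (suc i)

first : List ℕ → ℕ
first la = part la 1

oneTo : ℕ → List ℕ
oneTo = applyUpTo suc

conjPart : List ℕ → ℕ → ℕ
conjPart la j = length (filter (λ x → j Data.Nat.≤? x) la)

-- Hk_n : λ_1 + ℓ(λ) - 1 = n   (written without truncated subtraction)
InHk : ℕ → List ℕ → Set
InHk n la = first la + length la ≡ suc n

Fer : List ℕ → List (ℕ × ℕ)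
Fer la = concatMap (λ i → map (λ j → (i , j)) (oneTo (part la i))) (oneTo (length la))

lab : List ℕ → ℕ → ℕ
lab la i = (first la + i) ∸ part la i

rab : List ℕ → ℕ → ℕ
rab la j = (first la + 1 + conjPart la j) ∸ j

Diag : List ℕ → ℕ → List (ℕ × ℕ)
Diag la k = filter (λ { (i , j) → (first la + i) ≟ (k + j) }) (Fer la)

delta : List ℕ → ℕ → ℕ
delta la k = foldr _⊔_ 0 (map (λ { (i , j) → i ⊓ j }) (Diag la k))

Square : List ℕ → ℕ → List (ℕ × ℕ)
Square la k = filter (λ { (i' , j') → Data.Bool.T? (any (λ { (i , j) → (i' ≤ᵇ i) ∧ (j' ≤ᵇ j) }) (Diag la k)) }) (Fer la)

sumOver : (ℕ → ℕ → ℕ) → List (ℕ × ℕ) → ℕ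
sumOver f bs = sum (map (λ { (i , j) → f i j }) bs)

sumFrom1 : ℕ → (ℕ → ℕ) → ℕ
sumFrom1 zero    h = 0
sumFrom1 (suc m) h = sumFrom1 m h + h (suc m)

sTr : ℕ → ℕ → ℕ
sTr i x = if x ≡ᵇ i then suc i else (if x ≡ᵇ suc i then i else x)

-- s_{σ(1)} ⋯ s_{σ(n)}  (product = composition of maps, rightmost acts first),
-- σ given as the list [σ(1), …, σ(n)]
coxeter : List ℕ → ℕ → ℕ
coxeter σ = foldr (λ i h → sTr i ∘ h) id σ

Vtx : Set
Vtx = ℕ × ℕ

data IsPath (V : Vtx → Set) (E : Vtx → Vtx → Set) : List Vtx → Set where
  single : ∀ {v} → V v → IsPath V E (v ∷ [])
  step   : ∀ {v w vs} → V v → E v w → IsPath V E (w ∷ vs) → IsPath V E (v ∷ w ∷ vs)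

unionWeight : (Vtx → ℕ) → ∀ {m} → Vec (List Vtx) m → ℕ
unionWeight g ps = sum (map g (deduplicate (≡-dec _≟_ _≟_) (concat (toList ps))))

IsMaxSum : (V : Vtx → Set) (E : Vtx → Vtx → Set) (g : Vtx → ℕ) (m : ℕ) (x : ℕ) → Set
IsMaxSum V E g m x =
  (Σ (Vec (List Vtx) m) λ ps → VA.All (IsPath V E) ps × unionWeight g ps ≡ x)
  × (∀ (ps : Vec (List Vtx) m) → VA.All (IsPath V E) ps → unionWeight g ps ≤ x)

IsMaxSeq : (V : Vtx → Set) (E : Vtx → Vtx → Set) (g : Vtx → ℕ) (M : ℕ → ℕ) → Set
IsMaxSeq V E g M = M 0 ≡ 0 × (∀ m → 1 ≤ m → IsMaxSum V E g m (M m))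

-- GK_G(g)_δ = M_δ - M_{δ-1}   (δ ≥ 1; nonnegative since M is monotone)
GKentry : (ℕ → ℕ) → ℕ → ℕ
GKentry M d = M d ∸ M (d ∸ 1)

ARVtx : ℕ → ℕ → Vtx → Set
ARVtx n k (i , j) = (1 ≤ i × i < j × j ≤ suc n) × (i ≤ k × k < j)

AREdge : (ℕ → ℕ) → Vtx → Vtx → Set
AREdge c (i , j) (i' , j') = (i' ≡ i × j' ≡ c j × i < c j) ⊎ (i' ≡ c i × j' ≡ j × c i < j)

-- g(ℓ_i, r_j) = f(i,j) for (i,j) ∈ Fer(λ), 0 elsewhere
-- (the labels (ℓ_i, r_j) of distinct boxes are distinct, so the sum has ≤ 1 term)
weightAR : List ℕ → (ℕ → ℕ → ℕ) → Vtx → ℕ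
weightAR la f (a , b) =
  sum (map (λ { (i , j) → if (lab la i ≡ᵇ a) ∧ (rab la j ≡ᵇ b) then f i j else 0 }) (Fer la))

RSKval : (ℕ → ℕ) → ℕ → ℕ
RSKval M d = GKentry M d

-- A Coxeter element c of S_{n+1} is a single (n+1)-cycle that climbs from 1 to n+1
-- and then descends back to 1.  Hence the values in (k, n+1] form one arc of the
-- cycle and those in [1, k] another, so every row and every column of AR^[k](c) is
-- a path, and the graph is acyclic.  The box (i, j) of λ sits at the vertex
-- (ℓ_i, r_j), which lies in AR^[k](c) exactly when (i, j) ∈ □_k(λ).  Thus no family
-- of paths collects more than the total weight of □_k(λ), and the rows (or the
-- columns) of the rectangle spanned by the lowest box of D_k(λ) collect all of it
-- with at most δ_k paths.  So M_δ is that total weight, and the GK entries up to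
-- δ_k telescope to M_δ.
module Submission where

open import Defs
open import Data.Bool using (true; false; if_then_else_)
open import Data.Bool.Properties using (T-∧)
open import Data.Empty using (⊥-elim)
open import Data.List
  using (List; []; _∷_; _++_; [_]; _∷ʳ_; length; map; concat; filter; deduplicate; foldr;
         cartesianProduct; cartesianProductWith)
open import Data.List.Membership.Propositional using (_∈_; _∉_; find)
open import Data.List.Membership.Propositional.Properties
open import Data.List.Properties
  using (++-assoc; ++-identityʳ; applyUpTo-∷ʳ; length-map; length-applyUpTo; map-cong;
         filter-accept; filter-reject; filter-none; filter-all; length-filter)
import Data.List.Extrema
open import Data.List.Relation.Binary.Permutation.Propositional
  using (_↭_; ↭-sym; ↭-trans; ↭-prep; ↭-refl; ↭⇒↭ₛ; module PermutationReasoning)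
open import Data.List.Relation.Binary.Permutation.Propositional.Properties
  using (shift; drop-mid; ∈-resp-↭; ↭-singleton-inv; ∷↭∷ʳ; ++-comm; map⁺)
import Data.List.Relation.Binary.Permutation.Setoid.Properties as ↭ₛ
open import Data.List.Relation.Unary.All as All using (All; []; _∷_)
open import Data.List.Relation.Unary.All.Properties using (All¬⇒¬Any)
open import Data.List.Relation.Unary.Any as Any using (here; there)
open import Data.List.Relation.Unary.Any.Properties using (any⁺; any⁻)
open import Data.List.Relation.Unary.Linked as Linked using (Linked; []; [-]; _∷_)
open import Data.List.Relation.Unary.Unique.Propositional using (Unique; []; _∷_)
import Data.List.Relation.Unary.Unique.Propositional.Properties as Unique
import Data.List.Relation.Unary.Unique.DecPropositional.Properties as UniqueDec
open import Data.Nat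
  using (ℕ; zero; suc; _+_; _∸_; _≤_; _<_; _>_; _⊔_; _⊓_; _≡ᵇ_; z≤n; s≤s; s≤s⁻¹; _≤?_; _<?_)
open import Data.Nat.ListAction using (sum)
open import Data.Nat.ListAction.Properties using (sum-↭)
open import Data.Nat.Properties
open import Algebra.Properties.CommutativeSemigroup +-commutativeSemigroup using (interchange)
open import Data.List.Membership.DecPropositional _≟_ using (_∈?_)
open import Data.Product using (Σ; ∃; ∃₂; _×_; _,_; proj₁; proj₂; uncurry)
open import Data.Product.Properties using (≡-dec)
open import Data.Sum using (inj₁; inj₂)
open import Data.Vec using (Vec; []; _∷_; toList; fromList; replicate)
open import Data.Vec.Properties using (toList∘fromList)
open import Data.Vec.Relation.Unary.All as VA using ([]; _∷_)
import Data.Vec.Relation.Unary.All.Properties as VA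
open import Function using (_∘_; Equivalence)
open import Relation.Binary.Core using (Rel)
open import Relation.Binary.Definitions using (DecidableEquality)
open import Relation.Binary.PropositionalEquality
  using (_≡_; _≢_; refl; sym; trans; cong; cong₂; subst; subst₂; setoid; module ≡-Reasoning)
open import Relation.Nullary using (Dec; yes; no; ¬_; does)
open import Relation.Nullary.Decidable using (map′; dec-true; dec-false; _×-dec_; _⊎-dec_)
open import Relation.Unary using (Pred; Decidable)

module Extrema = Data.List.Extrema ≤-totalOrder

module _ {ℓ} {A : Set} {R : Rel A ℓ} where

  Linked-++⁻ˡ : ∀ xs {ys} → Linked R (xs ++ ys) → Linked R xs
  Linked-++⁻ˡ []           _       = []
  Linked-++⁻ˡ (x ∷ [])     _       = [-]
  Linked-++⁻ˡ (x ∷ y ∷ xs) (r ∷ l) = r ∷ Linked-++⁻ˡ (y ∷ xs) l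

  Linked-++⁻ʳ : ∀ xs {ys} → Linked R (xs ++ ys) → Linked R ys
  Linked-++⁻ʳ []       l = l
  Linked-++⁻ʳ (x ∷ xs) l = Linked-++⁻ʳ xs (Linked.tail l)

  Linked-join : ∀ xs {y ys} → Linked R (xs ++ [ y ]) → Linked R (y ∷ ys) → Linked R (xs ++ y ∷ ys)
  Linked-join []           _       l′ = l′
  Linked-join (x ∷ [])     (r ∷ _) l′ = r ∷ l′
  Linked-join (x ∷ z ∷ xs) (r ∷ l) l′ = r ∷ Linked-join (z ∷ xs) l l′

  Linked-snoc : ∀ x xs {y z} → Linked R (x ∷ xs ++ [ y ]) → R y z → Linked R (x ∷ (xs ++ [ y ]) ++ [ z ])
  Linked-snoc x xs {y} {z} l r =
    subst (Linked R ∘ (x ∷_)) (sym (++-assoc xs [ y ] [ z ])) (Linked-join (x ∷ xs) l (r ∷ [-]))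

  Linked-last : ∀ xs {y z} → (∀ {a} → R a y → R a z) → Linked R (xs ++ [ y ]) → Linked R (xs ++ [ z ])
  Linked-last []            _ [-]     = [-]
  Linked-last (x ∷ [])      w (r ∷ _) = w r ∷ [-]
  Linked-last (x ∷ x′ ∷ xs) w (r ∷ l) = r ∷ Linked-last (x′ ∷ xs) w l

  Linked-head : ∀ {x x′ ys} → (∀ {b} → R x b → R x′ b) → Linked R (x ∷ ys) → Linked R (x′ ∷ ys)
  Linked-head _ [-]     = [-]
  Linked-head w (r ∷ l) = w r ∷ l

  Linked-span : ∀ {p} {P : Pred A p} → Decidable P → (∀ {x y} → R x y → ¬ P x → ¬ P y) →
                ∀ xs → Linked R xs → ∃₂ λ ys zs → xs ≡ ys ++ zs × All P ys × All (¬_ ∘ P) zs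
  Linked-span P? stays []       _ = [] , [] , refl , [] , []
  Linked-span {P = P} P? stays (x ∷ xs) l with P? x
  ... | yes px with ys , zs , refl , pys , ¬pzs ← Linked-span P? stays xs (Linked.tail l)
    = x ∷ ys , zs , refl , px ∷ pys , ¬pzs
  ... | no ¬px = [] , x ∷ xs , refl , [] , fails ¬px l
    where
    fails : ∀ {x xs} → ¬ P x → Linked R (x ∷ xs) → All (¬_ ∘ P) (x ∷ xs)
    fails ¬px [-]     = ¬px ∷ []
    fails ¬px (r ∷ l) = ¬px ∷ fails (stays r ¬px) l

foldr-⊔-upper : ∀ {x xs} → x ∈ xs → x ≤ foldr _⊔_ 0 xs
foldr-⊔-upper {xs = y ∷ ys} (here refl) = m≤m⊔n y _
foldr-⊔-upper {xs = y ∷ ys} (there x∈) = ≤-trans (foldr-⊔-upper x∈) (m≤n⊔m y _)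

module _ {A : Set} where

  Unique-resp-↭ : ∀ {xs ys : List A} → xs ↭ ys → Unique ys → Unique xs
  Unique-resp-↭ p = ↭ₛ.Unique-resp-↭ (setoid A) (↭⇒↭ₛ (↭-sym p))

  unique-middle : ∀ xs {y ys} → Unique (xs ++ y ∷ ys) → y ∉ xs ++ ys
  unique-middle xs {y} {ys} u with Unique-resp-↭ (↭-sym (shift y xs ys)) u
  ... | y∉ ∷ _ = All¬⇒¬Any y∉

  unique-disjoint : ∀ xs {ys x} → Unique (xs ++ ys) → x ∈ xs → x ∉ ys
  unique-disjoint xs {ys} {x} u x∈xs x∈ys with ∈-∃++ x∈xs
  ... | as , bs , refl = unique-middle as (subst Unique (++-assoc as (x ∷ bs) ys) u) (∈-++⁺ʳ as (∈-++⁺ʳ bs x∈ys))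

  sum-map-mono-⊆ : ∀ (g : A → ℕ) {xs ys} → Unique xs → (∀ {x} → x ∈ xs → x ∈ ys) →
                   sum (map g xs) ≤ sum (map g ys)
  sum-map-mono-⊆ g {[]}     _          _   = z≤n
  sum-map-mono-⊆ g {x ∷ xs} (x∉ ∷ xs!) xs⊆ with ys₁ , ys₂ , refl ← ∈-∃++ (xs⊆ (here refl)) = begin
    g x + sum (map g xs)             ≤⟨ +-monoʳ-≤ (g x) (sum-map-mono-⊆ g xs! without-x) ⟩
    g x + sum (map g (ys₁ ++ ys₂))   ≡⟨ sum-↭ (map⁺ g (shift x ys₁ ys₂)) ⟨
    sum (map g (ys₁ ++ x ∷ ys₂))     ∎
    where
    open ≤-Reasoning
    without-x : ∀ {y} → y ∈ xs → y ∈ ys₁ ++ ys₂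
    without-x y∈ with ∈-++⁻ ys₁ (xs⊆ (there y∈))
    ... | inj₁ y∈₁         = ∈-++⁺ˡ y∈₁
    ... | inj₂ (here refl) = ⊥-elim (All.lookup x∉ y∈ refl)
    ... | inj₂ (there y∈₂) = ∈-++⁺ʳ ys₁ y∈₂

  length-mono-⊆ : ∀ {xs ys : List A} → Unique xs → (∀ {x} → x ∈ xs → x ∈ ys) → length xs ≤ length ys
  length-mono-⊆ {xs} {ys} xs! xs⊆ = subst₂ _≤_ (sum-ones xs) (sum-ones ys) (sum-map-mono-⊆ (λ _ → 1) xs! xs⊆)
    where
    sum-ones : ∀ zs → sum (map (λ _ → 1) zs) ≡ length zs
    sum-ones []       = refl
    sum-ones (_ ∷ zs) = cong suc (sum-ones zs)

  sum-map-+ : ∀ (g h : A → ℕ) xs → sum (map (λ x → g x + h x) xs) ≡ sum (map g xs) + sum (map h xs)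
  sum-map-+ g h []       = refl
  sum-map-+ g h (x ∷ xs) = trans (cong (g x + h x +_) (sum-map-+ g h xs)) (interchange (g x) (h x) _ _)

  module _ {p} {P : Pred A p} (P? : Decidable P) where

    sum-map-≤-filter : ∀ (g h : A → ℕ) xs → (∀ {x} → x ∈ xs → P x → g x ≤ h x) →
                       (∀ {x} → x ∈ xs → ¬ P x → g x ≡ 0) → sum (map g xs) ≤ sum (map h (filter P? xs))
    sum-map-≤-filter g h []       _   _   = z≤n
    sum-map-≤-filter g h (x ∷ xs) g≤h g≡0 with P? x
    ... | yes px = +-mono-≤ (g≤h (here refl) px) (sum-map-≤-filter g h xs (g≤h ∘ there) (g≡0 ∘ there))
    ... | no ¬px rewrite g≡0 (here refl) ¬px = sum-map-≤-filter g h xs (g≤h ∘ there) (g≡0 ∘ there)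

    sum-map-filter-≤ : ∀ (g h : A → ℕ) xs → (∀ {x} → x ∈ xs → P x → h x ≤ g x) →
                       sum (map h (filter P? xs)) ≤ sum (map g xs)
    sum-map-filter-≤ g h []       _   = z≤n
    sum-map-filter-≤ g h (x ∷ xs) h≤g with P? x
    ... | yes px = +-mono-≤ (h≤g (here refl) px) (sum-map-filter-≤ g h xs (h≤g ∘ there))
    ... | no _   = ≤-trans (sum-map-filter-≤ g h xs (h≤g ∘ there)) (m≤n+m _ (g x))

module Indicators {A B : Set} (_≟_ : DecidableEquality B) (label : A → B) (w : A → ℕ) where

  open import Data.List.Membership.DecPropositional _≟_ using () renaming (_∈?_ to _∈ᴮ?_)

  weightAt : List A → B → ℕ
  weightAt xs v = sum (map (λ x → if does (label x ≟ v) then w x else 0) xs)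

  weightIn : List A → List B → ℕ
  weightIn xs U = sum (map (λ x → if does (label x ∈ᴮ? U) then w x else 0) xs)

  sum-weightAt : ∀ xs {U} → Unique U → sum (map (weightAt xs) U) ≡ weightIn xs U
  sum-weightAt xs {[]}    _          = zeros xs
    where
    zeros : ∀ xs → 0 ≡ sum (map (λ _ → 0) xs)
    zeros []       = refl
    zeros (_ ∷ xs) = zeros xs
  sum-weightAt xs {u ∷ U} (u∉ ∷ U!) = begin
    weightAt xs u + sum (map (weightAt xs) U)   ≡⟨ cong (weightAt xs u +_) (sum-weightAt xs U!) ⟩
    weightAt xs u + weightIn xs U               ≡⟨ sum-map-+ _ _ xs ⟨
    sum (map (λ x → (if does (label x ≟ u) then w x else 0) + (if does (label x ∈ᴮ? U) then w x else 0)) xs)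
                                                ≡⟨ cong sum (map-cong one-label xs) ⟩
    weightIn xs (u ∷ U)                         ∎
    where
    open ≡-Reasoning
    one-label : ∀ x → (if does (label x ≟ u) then w x else 0) + (if does (label x ∈ᴮ? U) then w x else 0)
                      ≡ (if does (label x ∈ᴮ? u ∷ U) then w x else 0)
    one-label x with label x ≟ u | label x ∈ᴮ? U
    ... | yes refl | yes u∈ = ⊥-elim (All¬⇒¬Any u∉ u∈)
    ... | yes refl | no _   = +-identityʳ (w x)
    ... | no _     | _      = refl

-- Maxima over families of paths

unionWeight-mono : ∀ (g : Vtx → ℕ) {m m′} (ps : Vec (List Vtx) m) (qs : Vec (List Vtx) m′) →
  (∀ {v} → v ∈ concat (toList ps) → v ∈ concat (toList qs)) → unionWeight g ps ≤ unionWeight g qs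
unionWeight-mono g ps qs ⊆ = sum-map-mono-⊆ g (UniqueDec.deduplicate-! (≡-dec _≟_ _≟_) _)
  (∈-deduplicate⁺ (≡-dec _≟_ _≟_) ∘ ⊆ ∘ ∈-deduplicate⁻ (≡-dec _≟_ _≟_) _)

sumFrom1-telescope : ∀ (M : ℕ → ℕ) → M 0 ≡ 0 → (∀ m → M m ≤ M (suc m)) →
                     ∀ d → sumFrom1 d (RSKval M) ≡ M d
sumFrom1-telescope M M0≡0 mono zero    = sym M0≡0
sumFrom1-telescope M M0≡0 mono (suc d) =
  trans (cong (_+ (M (suc d) ∸ M d)) (sumFrom1-telescope M M0≡0 mono d)) (m+[n∸m]≡n (mono d))

module FiniteMaxima
  {V : Vtx → Set} (V? : Decidable V) {E : Vtx → Vtx → Set} (E? : ∀ v w → Dec (E v w))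
  (vertices : List Vtx) (vertices-complete : ∀ {v} → V v → v ∈ vertices)
  (Φ : Vtx → ℕ) (Φ-increasing : ∀ {v w} → V v → E v w → V w → Φ v < Φ w)
  where

  -- Φ makes paths duplicate-free, so no longer than the list of vertices: finitely
  -- many lists contain every path, and the maxima are attained.

  path-head : ∀ {v vs} → IsPath V E (v ∷ vs) → V v
  path-head (single Vv)   = Vv
  path-head (step Vv _ _) = Vv

  path-vertices : ∀ {vs} → IsPath V E vs → All V vs
  path-vertices (single Vv)   = Vv ∷ []
  path-vertices (step Vv _ p) = Vv ∷ path-vertices p

  path-increasing : ∀ {v vs} → IsPath V E (v ∷ vs) → All (λ w → Φ v < Φ w) vs
  path-increasing (single _) = []
  path-increasing {v} (step {w = w} Vv e p) = Φv<Φw ∷ All.map (<-trans Φv<Φw) (path-increasing p)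
    where
    Φv<Φw : Φ v < Φ w
    Φv<Φw = Φ-increasing Vv e (path-head p)

  path-unique : ∀ {vs} → IsPath V E vs → Unique vs
  path-unique (single _)      = [] ∷ []
  path-unique p@(step _ _ p′) =
    All.map (λ Φv<Φw v≡w → <-irrefl (cong Φ v≡w) Φv<Φw) (path-increasing p) ∷ path-unique p′

  tuple-vertices : ∀ {m} {ps : Vec (List Vtx) m} → VA.All (IsPath V E) ps →
                   ∀ {v} → v ∈ concat (toList ps) → V v
  tuple-vertices {ps = p ∷ ps} (p-path ∷ ps-paths) v∈ with ∈-++⁻ p v∈
  ... | inj₁ v∈p  = All.lookup (path-vertices p-path) v∈p
  ... | inj₂ v∈ps = tuple-vertices ps-paths v∈ps

  isPath? : Decidable (IsPath V E)
  isPath? []           = no λ ()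
  isPath? (v ∷ [])     with V? v
  ... | yes Vv = yes (single Vv)
  ... | no ¬Vv = no λ { (single Vv) → ¬Vv Vv }
  isPath? (v ∷ w ∷ vs) with V? v | E? v w | isPath? (w ∷ vs)
  ... | yes Vv | yes e | yes p = yes (step Vv e p)
  ... | no ¬Vv | _     | _     = no λ { (step Vv _ _) → ¬Vv Vv }
  ... | yes _  | no ¬e | _     = no λ { (step _ e _) → ¬e e }
  ... | yes _  | yes _ | no ¬p = no λ { (step _ _ p) → ¬p p }

  listsUpTo : ℕ → List (List Vtx)
  listsUpTo zero    = [ [] ]
  listsUpTo (suc N) = [] ∷ cartesianProductWith _∷_ vertices (listsUpTo N)

  listsUpTo-complete : ∀ N {ws} → All (_∈ vertices) ws → length ws ≤ N → ws ∈ listsUpTo N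
  listsUpTo-complete zero    []         _       = here refl
  listsUpTo-complete (suc N) []         _       = here refl
  listsUpTo-complete (suc N) (w∈ ∷ ws∈) (s≤s l) =
    there (∈-cartesianProductWith⁺ _∷_ w∈ (listsUpTo-complete N ws∈ l))

  paths : List (List Vtx)
  paths = filter isPath? (listsUpTo (length vertices))

  paths-complete : ∀ {p} → IsPath V E p → p ∈ paths
  paths-complete {p} p-path = ∈-filter⁺ isPath?
    (listsUpTo-complete (length vertices) p⊆ (length-mono-⊆ (path-unique p-path) (All.lookup p⊆))) p-path
    where
    p⊆ : All (_∈ vertices) p
    p⊆ = All.map vertices-complete (path-vertices p-path)

  paths-sound : ∀ {p} → p ∈ paths → IsPath V E p
  paths-sound p∈ = proj₂ (∈-filter⁻ isPath? {xs = listsUpTo (length vertices)} p∈)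

  tuples : (m : ℕ) → List (Vec (List Vtx) m)
  tuples zero    = [ [] ]
  tuples (suc m) = cartesianProductWith _∷_ paths (tuples m)

  tuples-complete : ∀ {m} {ps : Vec (List Vtx) m} → VA.All (IsPath V E) ps → ps ∈ tuples m
  tuples-complete []       = here refl
  tuples-complete (p ∷ ps) = ∈-cartesianProductWith⁺ _∷_ (paths-complete p) (tuples-complete ps)

  tuples-sound : ∀ {m} {ps : Vec (List Vtx) m} → ps ∈ tuples m → VA.All (IsPath V E) ps
  tuples-sound {zero}  {[]} _ = []
  tuples-sound {suc m}      ps∈
    with _ , _ , p∈ , qs∈ , refl ← ∈-cartesianProductWith⁻ _∷_ paths (tuples m) ps∈
    = paths-sound p∈ ∷ tuples-sound qs∈

  module Maxima (g : Vtx → ℕ) {v₀ : Vtx} (V-v₀ : V v₀) where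

    trivial : ∀ m → Vec (List Vtx) m
    trivial m = replicate m [ v₀ ]

    trivial-paths : ∀ m → VA.All (IsPath V E) (trivial m)
    trivial-paths zero    = []
    trivial-paths (suc m) = single V-v₀ ∷ trivial-paths m

    best : ∀ m → Vec (List Vtx) m
    best m = Extrema.argmax (unionWeight g) (trivial m) (tuples m)

    M : ℕ → ℕ
    M m = unionWeight g (best m)

    best-paths : ∀ m → VA.All (IsPath V E) (best m)
    best-paths m = Extrema.argmax-all (unionWeight g) (trivial-paths m) (All.tabulate tuples-sound)

    M-maximal : ∀ {m} (ps : Vec (List Vtx) m) → VA.All (IsPath V E) ps → unionWeight g ps ≤ M m
    M-maximal {m} _ ps-paths =
      All.lookup (Extrema.f[xs]≤f[argmax] (trivial m) (tuples m)) (tuples-complete ps-paths)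

    M-isMaxSeq : IsMaxSeq V E g M
    M-isMaxSeq = refl , λ m _ → (best m , best-paths m , refl) , M-maximal

    M-monotone : ∀ m → M m ≤ M (suc m)
    M-monotone m = ≤-trans (unionWeight-mono g (best m) ([ v₀ ] ∷ best m) there)
                           (M-maximal ([ v₀ ] ∷ best m) (single V-v₀ ∷ best-paths m))

    M-mono-≤ : ∀ {m m′} → m ≤ m′ → M m ≤ M m′
    M-mono-≤ {m} {zero}   z≤n = ≤-refl
    M-mono-≤ {m} {suc m′} m≤1+m′ with m≤n⇒m<n∨m≡n m≤1+m′
    ... | inj₂ refl       = ≤-refl
    ... | inj₁ (s≤s m≤m′) = ≤-trans (M-mono-≤ m≤m′) (M-monotone m′)

    sumFrom1-RSK : ∀ d → sumFrom1 d (RSKval M) ≡ M d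
    sumFrom1-RSK = sumFrom1-telescope M refl M-monotone

-- Coxeter elements as unimodal cycles

-- the decision m ≟ n is computed by m ≡ᵇ n, the test used in sTr
≡ᵇ-false : ∀ {m n} → m ≢ n → (m ≡ᵇ n) ≡ false
≡ᵇ-false {m} {n} = dec-false (m ≟ n)

≡ᵇ-refl : ∀ n → (n ≡ᵇ n) ≡ true
≡ᵇ-refl n = dec-true (n ≟ n) refl

sTr-fix : ∀ {i x} → x ≢ i → x ≢ suc i → sTr i x ≡ x
sTr-fix x≢i x≢1+i rewrite ≡ᵇ-false x≢i | ≡ᵇ-false x≢1+i = refl

sTr-fix-above : ∀ {i x} → suc i < x → sTr i x ≡ x
sTr-fix-above 1+i<x = sTr-fix (>⇒≢ (<-trans (n<1+n _) 1+i<x)) (>⇒≢ 1+i<x)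

sTr-left : ∀ i → sTr i i ≡ suc i
sTr-left i rewrite ≡ᵇ-refl i = refl

sTr-right : ∀ i → sTr i (suc i) ≡ i
sTr-right i rewrite ≡ᵇ-false (1+n≢n {i}) | ≡ᵇ-refl i = refl

sTr-involutive : ∀ i x → sTr i (sTr i x) ≡ x
sTr-involutive i x with x ≟ i | x ≟ suc i
... | yes refl | _        = trans (cong (sTr i) (sTr-left i)) (sTr-right i)
... | no _     | yes refl = trans (cong (sTr i) (sTr-right i)) (sTr-left i)
... | no x≢i   | no x≢1+i = trans (cong (sTr i) (sTr-fix x≢i x≢1+i)) (sTr-fix x≢i x≢1+i)

coxeter-++ : ∀ xs ys x → coxeter (xs ++ ys) x ≡ coxeter xs (coxeter ys x)
coxeter-++ []       ys x = refl
coxeter-++ (i ∷ xs) ys x = cong (sTr i) (coxeter-++ xs ys x)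

coxeter-injective : ∀ γ {x y} → coxeter γ x ≡ coxeter γ y → x ≡ y
coxeter-injective []      e = e
coxeter-injective (i ∷ γ) {x} {y} e = coxeter-injective γ (begin
  coxeter γ x                   ≡⟨ sym (sTr-involutive i _) ⟩
  sTr i (sTr i (coxeter γ x))   ≡⟨ cong (sTr i) e ⟩
  sTr i (sTr i (coxeter γ y))   ≡⟨ sTr-involutive i _ ⟩
  coxeter γ y                   ∎)
  where open ≡-Reasoning

coxeter-fix : ∀ {x} γ → All (λ i → suc i < x) γ → coxeter γ x ≡ x
coxeter-fix []      []           = refl
coxeter-fix (i ∷ γ) (1+i<x ∷ γ<) = trans (cong (sTr i) (coxeter-fix γ γ<)) (sTr-fix-above 1+i<x)

oneTo-∈⁻ : ∀ {n x} → x ∈ oneTo n → 1 ≤ x × x ≤ n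
oneTo-∈⁻ x∈ with ∈-applyUpTo⁻ suc x∈
... | _ , i<n , refl = s≤s z≤n , i<n

oneTo-∈⁺ : ∀ {n x} → 1 ≤ x → x ≤ n → x ∈ oneTo n
oneTo-∈⁺ {x = suc x} _ x<n = ∈-applyUpTo⁺ suc x<n

oneTo-unique : ∀ n → Unique (oneTo n)
oneTo-unique n = Unique.applyUpTo⁺₁ suc n (λ i<j _ → <⇒≢ i<j ∘ suc-injective)

oneTo-insert-top : ∀ {n} xs {ys} → xs ++ ys ↭ oneTo n → xs ++ suc n ∷ ys ↭ oneTo (suc n)
oneTo-insert-top {n} xs {ys} p = begin
  xs ++ [ suc n ] ++ ys   ↭⟨ shift (suc n) xs ys ⟩
  suc n ∷ xs ++ ys        ↭⟨ ↭-prep (suc n) p ⟩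
  suc n ∷ oneTo n         ↭⟨ ∷↭∷ʳ (suc n) (oneTo n) ⟩
  oneTo n ∷ʳ suc n        ≡⟨ applyUpTo-∷ʳ suc n ⟩
  oneTo (suc n)           ∎
  where open PermutationReasoning

oneTo-remove-top : ∀ {n} α β → α ++ suc n ∷ β ↭ oneTo (suc n) → α ++ β ↭ oneTo n
oneTo-remove-top {n} α β p = subst (α ++ β ↭_) (++-identityʳ (oneTo n))
  (drop-mid α (oneTo n) (subst (α ++ suc n ∷ β ↭_) (sym (applyUpTo-∷ʳ suc n)) p))

IsArc : (ℕ → ℕ) → List ℕ → Set
IsArc c = Linked (λ a b → c a ≡ b)

arc-image : ∀ {c} x ys {w y} → IsArc c (x ∷ ys ++ [ w ]) → y ∈ x ∷ ys → c y ∈ ys ++ [ w ]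
arc-image x []       (e ∷ [-]) (here refl) = here e
arc-image x (z ∷ ys) (e ∷ _)   (here refl) = here e
arc-image x (z ∷ ys) (e ∷ l)   (there y∈)  = there (arc-image z ys l y∈)

arc-step : ∀ {ℓ} {R : Rel ℕ ℓ} {c w} xs {y} → Linked R xs → IsArc c (xs ++ [ w ]) →
           y ∈ xs → c y ≢ w → R y (c y)
arc-step (x ∷ [])     _       (e ∷ [-]) (here refl) ≢w = ⊥-elim (≢w e)
arc-step {R = R} (x ∷ x′ ∷ xs) (r ∷ _) (e ∷ _) (here refl) ≢w = subst (R x) (sym e) r
arc-step (x ∷ x′ ∷ xs) (_ ∷ l) (_ ∷ a) (there y∈) ≢w = arc-step (x′ ∷ xs) l a y∈ ≢w

arc-transport : ∀ {c d x x′ w} ys → c x′ ≡ d x → (∀ {y} → y ∈ ys → c y ≡ d y) →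
                IsArc d (x ∷ ys ++ [ w ]) → IsArc c (x′ ∷ ys ++ [ w ])
arc-transport []       h _     (e ∷ [-]) = trans h e ∷ [-]
arc-transport (y ∷ ys) h agree (e ∷ l)   = trans h e ∷ arc-transport ys (agree (here refl)) (agree ∘ there) l

arc-retarget : ∀ {c d w w′} xs → w ∉ xs → (∀ {y} → y ∈ xs → d y ≢ w → c y ≡ d y) →
               (∀ {y} → y ∈ xs → d y ≡ w → c y ≡ w′) → IsArc d (xs ++ [ w ]) → IsArc c (xs ++ [ w′ ])
arc-retarget []           _  _    _   [-]       = [-]
arc-retarget (x ∷ [])     _  _    hit (e ∷ [-]) = hit (here refl) e ∷ [-]
arc-retarget (x ∷ y ∷ xs) w∉ keep hit (e ∷ l)   =
  trans (keep (here refl) (λ e′ → w∉ (there (here (trans (sym e′) e))))) e ∷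
  arc-retarget (y ∷ xs) (w∉ ∘ there) (keep ∘ there) (hit ∘ there) l

record UnimodalCycle (n : ℕ) (c : ℕ → ℕ) : Set where
  field
    ascent descent : List ℕ
    ascending   : Linked _<_ (1 ∷ ascent ++ [ suc n ])
    descending  : Linked _>_ (suc n ∷ descent ++ [ 1 ])
    ascent-arc  : IsArc c (1 ∷ ascent ++ [ suc n ])
    descent-arc : IsArc c (suc n ∷ descent ++ [ 1 ])
    permutes    : 1 ∷ ascent ++ suc n ∷ descent ↭ oneTo (suc n)

-- Inserting the generator s_N into a Coxeter element α ++ β of S_N inserts N + 1
-- into its cycle next to N.
module InsertTop (n : ℕ) (α β : List ℕ) (αβ↭ : α ++ β ↭ oneTo (suc n))
                 (old : UnimodalCycle (suc n) (coxeter (α ++ β))) where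

  open UnimodalCycle old

  N : ℕ
  N = suc (suc n)

  τ c : ℕ → ℕ
  τ = coxeter (α ++ β)
  c = coxeter (α ++ N ∷ β)

  τ-split : ∀ x → τ x ≡ coxeter α (coxeter β x)
  τ-split = coxeter-++ α β

  c-split : ∀ x → c x ≡ coxeter α (sTr N (coxeter β x))
  c-split = coxeter-++ α (N ∷ β)

  generator-≤ : ∀ {i} → i ∈ α ++ β → i ≤ suc n
  generator-≤ i∈ = proj₂ (oneTo-∈⁻ (∈-resp-↭ αβ↭ i∈))

  fixes-above : ∀ γ → (∀ {i} → i ∈ γ → i ∈ α ++ β) → coxeter γ (suc N) ≡ suc N
  fixes-above γ γ⊆ = coxeter-fix γ (All.tabulate (λ i∈ → s≤s (s≤s (generator-≤ (γ⊆ i∈)))))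

  α-fixes-top : coxeter α (suc N) ≡ suc N
  α-fixes-top = fixes-above α ∈-++⁺ˡ

  β-fixes-top : coxeter β (suc N) ≡ suc N
  β-fixes-top = fixes-above β (∈-++⁺ʳ α)

  fixes-N : ∀ γ → (∀ {i} → i ∈ γ → i ∈ α ++ β) → suc n ∉ γ → coxeter γ N ≡ N
  fixes-N γ γ⊆ n∉ = coxeter-fix γ (All.tabulate (λ {i} i∈ →
    s≤s (≤∧≢⇒< (generator-≤ (γ⊆ i∈)) (λ { refl → n∉ i∈ }))))

  agree : ∀ {x} → x ≤ N → coxeter β x ≢ N → c x ≡ τ x
  agree {x} x≤N βx≢N = begin
    c x                                 ≡⟨ c-split x ⟩
    coxeter α (sTr N (coxeter β x))     ≡⟨ cong (coxeter α) (sTr-fix βx≢N βx≢1+N) ⟩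
    coxeter α (coxeter β x)             ≡⟨ τ-split x ⟨
    τ x                                 ∎
    where
    open ≡-Reasoning
    βx≢1+N : coxeter β x ≢ suc N
    βx≢1+N e = <⇒≢ (s≤s x≤N) (coxeter-injective β (trans e (sym β-fixes-top)))

  old-list : List ℕ
  old-list = 1 ∷ ascent ++ N ∷ descent

  ≤N : ∀ {x} → x ∈ old-list → x ≤ N
  ≤N x∈ = proj₂ (oneTo-∈⁻ (∈-resp-↭ permutes x∈))

  N∉ : N ∉ (1 ∷ ascent) ++ descent
  N∉ = unique-middle (1 ∷ ascent) (Unique-resp-↭ permutes (oneTo-unique N))

  N∉ascent : N ∉ 1 ∷ ascent
  N∉ascent = N∉ ∘ ∈-++⁺ˡ

  N∉descent : N ∉ descent
  N∉descent = N∉ ∘ ∈-++⁺ʳ (1 ∷ ascent)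

  -- s_{n+1} acts after s_N: N + 1 enters the cycle right after N, which joins the ascent
  module Up (n∉β : suc n ∉ β) where

    β-fixes-N : coxeter β N ≡ N
    β-fixes-N = fixes-N β (∈-++⁺ʳ α) n∉β

    agree-up : ∀ {x} → x ∈ old-list → x ≢ N → c x ≡ τ x
    agree-up x∈ x≢N = agree (≤N x∈) (λ βx≡N → x≢N (coxeter-injective β (trans βx≡N (sym β-fixes-N))))

    c-N : c N ≡ suc N
    c-N = begin
      c N                              ≡⟨ c-split N ⟩
      coxeter α (sTr N (coxeter β N))  ≡⟨ cong (coxeter α ∘ sTr N) β-fixes-N ⟩
      coxeter α (sTr N N)              ≡⟨ cong (coxeter α) (sTr-left N) ⟩
      coxeter α (suc N)                ≡⟨ α-fixes-top ⟩
      suc N                            ∎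
      where open ≡-Reasoning

    c-top : c (suc N) ≡ τ N
    c-top = begin
      c (suc N)                             ≡⟨ c-split (suc N) ⟩
      coxeter α (sTr N (coxeter β (suc N))) ≡⟨ cong (coxeter α ∘ sTr N) β-fixes-top ⟩
      coxeter α (sTr N (suc N))             ≡⟨ cong (coxeter α) (sTr-right N) ⟩
      coxeter α N                           ≡⟨ cong (coxeter α) β-fixes-N ⟨
      coxeter α (coxeter β N)               ≡⟨ τ-split N ⟨
      τ N                                   ∎
      where open ≡-Reasoning

    cycle : UnimodalCycle N c
    cycle = record
      { ascent      = ascent ++ [ N ]
      ; descent     = descent
      ; ascending   = Linked-snoc 1 ascent ascending (n<1+n N)
      ; descending  = Linked-head (λ b<N → <-trans b<N (n<1+n N)) descending
      ; ascent-arc  = Linked-snoc 1 ascent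
          (arc-transport ascent (agree-up (here refl) (N∉ascent ∘ here ∘ sym))
            (λ y∈ → agree-up (there (∈-++⁺ˡ y∈)) (λ { refl → N∉ascent (there y∈) })) ascent-arc)
          c-N
      ; descent-arc = arc-transport descent c-top
          (λ y∈ → agree-up (there (∈-++⁺ʳ ascent (there y∈))) (λ { refl → N∉descent y∈ })) descent-arc
      ; permutes    = oneTo-insert-top (1 ∷ ascent ++ [ N ])
          (subst (_↭ oneTo N) (cong (1 ∷_) (sym (++-assoc ascent [ N ] descent))) permutes)
      }

  -- s_{n+1} acts before s_N: N + 1 enters the cycle right before N, which joins the descent
  module Down (n∈β : suc n ∈ β) where

    α-fixes-N : coxeter α N ≡ N
    α-fixes-N = fixes-N α ∈-++⁺ˡ (λ n∈α →
      unique-disjoint α (Unique-resp-↭ αβ↭ (oneTo-unique (suc n))) n∈α n∈β)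

    c-top : c (suc N) ≡ N
    c-top = begin
      c (suc N)                             ≡⟨ c-split (suc N) ⟩
      coxeter α (sTr N (coxeter β (suc N))) ≡⟨ cong (coxeter α ∘ sTr N) β-fixes-top ⟩
      coxeter α (sTr N (suc N))             ≡⟨ cong (coxeter α) (sTr-right N) ⟩
      coxeter α N                           ≡⟨ α-fixes-N ⟩
      N                                     ∎
      where open ≡-Reasoning

    agree-down : ∀ {x} → x ∈ old-list → τ x ≢ N → c x ≡ τ x
    agree-down x∈ τx≢N =
      agree (≤N x∈) (λ βx≡N → τx≢N (trans (τ-split _) (trans (cong (coxeter α) βx≡N) α-fixes-N)))

    redirect : ∀ {x} → τ x ≡ N → c x ≡ suc N
    redirect {x} τx≡N = begin
      c x                              ≡⟨ c-split x ⟩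
      coxeter α (sTr N (coxeter β x))  ≡⟨ cong (coxeter α ∘ sTr N) βx≡N ⟩
      coxeter α (sTr N N)              ≡⟨ cong (coxeter α) (sTr-left N) ⟩
      coxeter α (suc N)                ≡⟨ α-fixes-top ⟩
      suc N                            ∎
      where
      open ≡-Reasoning
      βx≡N : coxeter β x ≡ N
      βx≡N = coxeter-injective α (trans (sym (τ-split x)) (trans τx≡N (sym α-fixes-N)))

    τ-avoids-N : ∀ {y} → y ∈ N ∷ descent → τ y ≢ N
    τ-avoids-N y∈ τy≡N
      with ∈-++⁻ descent (subst (_∈ descent ++ [ 1 ]) τy≡N (arc-image N descent descent-arc y∈))
    ... | inj₁ N∈ = N∉descent N∈
    ... | inj₂ (here ())

    cycle : UnimodalCycle N c
    cycle = record
      { ascent      = ascent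
      ; descent     = N ∷ descent
      ; ascending   = Linked-last (1 ∷ ascent) (λ a<N → <-trans a<N (n<1+n N)) ascending
      ; descending  = n<1+n N ∷ descending
      ; ascent-arc  = arc-retarget (1 ∷ ascent) N∉ascent
          (λ y∈ → agree-down (∈-++⁺ˡ y∈)) (λ _ → redirect) ascent-arc
      ; descent-arc = c-top ∷ arc-transport descent
          (agree-down (∈-++⁺ʳ (1 ∷ ascent) (here refl)) (τ-avoids-N (here refl)))
          (λ y∈ → agree-down (∈-++⁺ʳ (1 ∷ ascent) (there y∈)) (τ-avoids-N (there y∈))) descent-arc
      ; permutes    = oneTo-insert-top (1 ∷ ascent) permutes
      }

coxeter-unimodal : ∀ n {σ} → σ ↭ oneTo (suc n) → UnimodalCycle (suc n) (coxeter σ)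
coxeter-unimodal zero p with ↭-singleton-inv p
... | refl = record
  { ascent = [] ; descent = []
  ; ascending = s≤s (s≤s z≤n) ∷ [-] ; descending = s≤s (s≤s z≤n) ∷ [-]
  ; ascent-arc = refl ∷ [-] ; descent-arc = refl ∷ [-]
  ; permutes = ↭-refl }
coxeter-unimodal (suc n) p
  with α , β , refl ← ∈-∃++ (∈-resp-↭ (↭-sym p) (oneTo-∈⁺ {suc (suc n)} (s≤s z≤n) ≤-refl))
  with αβ↭ ← oneTo-remove-top α β p
  with suc n ∈? β
... | yes n∈β = InsertTop.Down.cycle n α β αβ↭ (coxeter-unimodal n αβ↭) n∈β
... | no  n∉β = InsertTop.Up.cycle   n α β αβ↭ (coxeter-unimodal n αβ↭) n∉β

-- The two arcs of a unimodal cycle cut at k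

position : List ℕ → ℕ → ℕ
position []       x = 0
position (y ∷ ys) x = if x ≡ᵇ y then 0 else suc (position ys x)

positions-increase : ∀ {xs} → Unique xs → Linked (λ a b → position xs a < position xs b) xs
positions-increase {[]}          _                  = []
positions-increase {x ∷ []}      _                  = [-]
positions-increase {x ∷ y ∷ xs}  ((x≢y ∷ x∉) ∷ u)   =
  subst₂ _<_ (sym here₀) (sym (there₀ (x≢y ∘ sym))) (s≤s z≤n) ∷
  past-head (x≢y ∷ x∉) (positions-increase u)
  where
  here₀ : position (x ∷ y ∷ xs) x ≡ 0
  here₀ rewrite dec-true (x ≟ x) refl = refl
  there₀ : ∀ {z} → z ≢ x → position (x ∷ y ∷ xs) z ≡ suc (position (y ∷ xs) z)
  there₀ {z} z≢x rewrite dec-false (z ≟ x) z≢x = refl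
  past-head : ∀ {zs} → All (x ≢_) zs → Linked (λ a b → position (y ∷ xs) a < position (y ∷ xs) b) zs →
          Linked (λ a b → position (x ∷ y ∷ xs) a < position (x ∷ y ∷ xs) b) zs
  past-head _                  []      = []
  past-head _                  [-]     = [-]
  past-head (x≢a ∷ x≢b ∷ x≢zs) (r ∷ l) =
    subst₂ _<_ (sym (there₀ (x≢a ∘ sym))) (sym (there₀ (x≢b ∘ sym))) (s≤s r) ∷ past-head (x≢b ∷ x≢zs) l

record Chain (c : ℕ → ℕ) (P : ℕ → Set) : Set where
  field
    elements : List ℕ
    arc      : IsArc c elements
    sound    : ∀ {x} → x ∈ elements → P x
    complete : ∀ {x} → P x → x ∈ elements

module Arcs {n c} (uc : UnimodalCycle n c) where

  open UnimodalCycle uc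

  cycle-from-1 cycle-from-top : List ℕ
  cycle-from-1 = 1 ∷ ascent ++ suc n ∷ descent
  cycle-from-top = suc n ∷ descent ++ 1 ∷ ascent

  cycle-∈⁻ : ∀ {x} → x ∈ cycle-from-1 → 1 ≤ x × x ≤ suc n
  cycle-∈⁻ = oneTo-∈⁻ ∘ ∈-resp-↭ permutes

  cycle-∈⁺ : ∀ {x} → 1 ≤ x → x ≤ suc n → x ∈ cycle-from-1
  cycle-∈⁺ 1≤x x≤n = ∈-resp-↭ (↭-sym permutes) (oneTo-∈⁺ 1≤x x≤n)

  cycle-from-top↭ : cycle-from-top ↭ cycle-from-1
  cycle-from-top↭ = ++-comm (suc n ∷ descent) (1 ∷ ascent)

  cycle-from-1-arc : IsArc c (cycle-from-1 ++ [ 1 ])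
  cycle-from-1-arc = subst (IsArc c ∘ (1 ∷_)) (sym (++-assoc ascent (suc n ∷ descent) [ 1 ]))
    (Linked-join (1 ∷ ascent) ascent-arc descent-arc)

  cycle-from-top-arc : IsArc c (cycle-from-top ++ [ suc n ])
  cycle-from-top-arc = subst (IsArc c ∘ (suc n ∷_)) (sym (++-assoc descent (1 ∷ ascent) [ suc n ]))
    (Linked-join (suc n ∷ descent) descent-arc ascent-arc)

  position-step-from-1 : ∀ {x} → 1 ≤ x → x ≤ suc n → c x ≢ 1 →
                         position cycle-from-1 x < position cycle-from-1 (c x)
  position-step-from-1 1≤x x≤n cx≢1 = arc-step cycle-from-1
    (positions-increase (Unique-resp-↭ permutes (oneTo-unique (suc n))))
    cycle-from-1-arc (cycle-∈⁺ 1≤x x≤n) cx≢1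

  position-step-from-top : ∀ {x} → 1 ≤ x → x ≤ suc n → c x ≢ suc n →
                           position cycle-from-top x < position cycle-from-top (c x)
  position-step-from-top 1≤x x≤n cx≢top = arc-step cycle-from-top
    (positions-increase (Unique-resp-↭ (↭-trans cycle-from-top↭ permutes) (oneTo-unique (suc n))))
    cycle-from-top-arc (∈-resp-↭ (↭-sym cycle-from-top↭) (cycle-∈⁺ 1≤x x≤n)) cx≢top

  module Threshold (k : ℕ) (1≤k : 1 ≤ k) (k≤n : k ≤ n) where

    ascent-split : ∃₂ λ ys zs → ascent ≡ ys ++ zs × All (_≤ k) ys × All (λ x → ¬ x ≤ k) zs
    ascent-split = Linked-span (_≤? k) (λ x<y x≰k y≤k → x≰k (<⇒≤ (<-≤-trans x<y y≤k)))
      ascent (Linked-++⁻ˡ ascent (Linked.tail ascending))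

    descent-split : ∃₂ λ ys zs → descent ≡ ys ++ zs × All (k <_) ys × All (λ x → ¬ k < x) zs
    descent-split = Linked-span (k <?_) (λ y<x k≮x k<y → k≮x (<-trans k<y y<x))
      descent (Linked-++⁻ˡ descent (Linked.tail descending))

    U₁ U₂ D₁ D₂ : List ℕ
    U₁ = proj₁ ascent-split
    U₂ = proj₁ (proj₂ ascent-split)
    D₁ = proj₁ descent-split
    D₂ = proj₁ (proj₂ descent-split)

    ascent≡ : ascent ≡ U₁ ++ U₂
    ascent≡ = proj₁ (proj₂ (proj₂ ascent-split))

    descent≡ : descent ≡ D₁ ++ D₂
    descent≡ = proj₁ (proj₂ (proj₂ descent-split))

    U₁≤k : All (_≤ k) U₁
    U₁≤k = proj₁ (proj₂ (proj₂ (proj₂ ascent-split)))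

    U₂>k : All (λ x → ¬ x ≤ k) U₂
    U₂>k = proj₂ (proj₂ (proj₂ (proj₂ ascent-split)))

    D₁>k : All (k <_) D₁
    D₁>k = proj₁ (proj₂ (proj₂ (proj₂ descent-split)))

    D₂≤k : All (λ x → ¬ k < x) D₂
    D₂≤k = proj₂ (proj₂ (proj₂ (proj₂ descent-split)))

    ascent-arc′ : IsArc c ((1 ∷ U₁) ++ U₂ ++ [ suc n ])
    ascent-arc′ = subst (IsArc c ∘ (1 ∷_))
      (trans (cong (_++ [ suc n ]) ascent≡) (++-assoc U₁ U₂ [ suc n ])) ascent-arc

    descent-arc′ : IsArc c ((suc n ∷ D₁) ++ D₂ ++ [ 1 ])
    descent-arc′ = subst (IsArc c ∘ (suc n ∷_))
      (trans (cong (_++ [ 1 ]) descent≡) (++-assoc D₁ D₂ [ 1 ])) descent-arc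

    data Region (x : ℕ) : Set where
      bottom       : x ≡ 1 → Region x
      low-ascent   : x ∈ U₁ → Region x
      high-ascent  : x ∈ U₂ → Region x
      top          : x ≡ suc n → Region x
      high-descent : x ∈ D₁ → Region x
      low-descent  : x ∈ D₂ → Region x

    from-ascent : ∀ {x} → x ∈ U₁ ++ U₂ → x ∈ cycle-from-1
    from-ascent x∈ = there (∈-++⁺ˡ (subst (_ ∈_) (sym ascent≡) x∈))

    from-descent : ∀ {x} → x ∈ D₁ ++ D₂ → x ∈ cycle-from-1
    from-descent x∈ = there (∈-++⁺ʳ ascent (there (subst (_ ∈_) (sym descent≡) x∈)))

    region : ∀ {x} → x ∈ cycle-from-1 → Region x
    region (here x≡1) = bottom x≡1
    region (there x∈) with ∈-++⁻ ascent x∈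
    ... | inj₁ x∈a with ∈-++⁻ U₁ (subst (_ ∈_) ascent≡ x∈a)
    ...   | inj₁ x∈U₁ = low-ascent x∈U₁
    ...   | inj₂ x∈U₂ = high-ascent x∈U₂
    region (there x∈) | inj₂ (here x≡top) = top x≡top
    region (there x∈) | inj₂ (there x∈d) with ∈-++⁻ D₁ (subst (_ ∈_) descent≡ x∈d)
    ...   | inj₁ x∈D₁ = high-descent x∈D₁
    ...   | inj₂ x∈D₂ = low-descent x∈D₂

    upper : Chain c (λ y → k < y × y ≤ suc n)
    upper = record
      { elements = U₂ ++ suc n ∷ D₁
      ; arc      = Linked-join U₂ (Linked-++⁻ʳ (1 ∷ U₁) ascent-arc′) (Linked-++⁻ˡ (suc n ∷ D₁) descent-arc′)
      ; sound    = sound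
      ; complete = complete
      }
      where
      sound : ∀ {y} → y ∈ U₂ ++ suc n ∷ D₁ → k < y × y ≤ suc n
      sound y∈ with ∈-++⁻ U₂ y∈
      ... | inj₁ y∈U₂         =
        ≰⇒> (All.lookup U₂>k y∈U₂) , proj₂ (cycle-∈⁻ (from-ascent (∈-++⁺ʳ U₁ y∈U₂)))
      ... | inj₂ (here refl)  = s≤s k≤n , ≤-refl
      ... | inj₂ (there y∈D₁) =
        All.lookup D₁>k y∈D₁ , proj₂ (cycle-∈⁻ (from-descent (∈-++⁺ˡ y∈D₁)))
      complete : ∀ {y} → k < y × y ≤ suc n → y ∈ U₂ ++ suc n ∷ D₁
      complete (k<y , y≤n) with region (cycle-∈⁺ (≤-trans (s≤s z≤n) k<y) y≤n)
      ... | bottom refl       = ⊥-elim (<⇒≱ k<y 1≤k)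
      ... | low-ascent y∈U₁   = ⊥-elim (<⇒≱ k<y (All.lookup U₁≤k y∈U₁))
      ... | high-ascent y∈U₂  = ∈-++⁺ˡ y∈U₂
      ... | top refl          = ∈-++⁺ʳ U₂ (here refl)
      ... | high-descent y∈D₁ = ∈-++⁺ʳ U₂ (there y∈D₁)
      ... | low-descent y∈D₂  = ⊥-elim (All.lookup D₂≤k y∈D₂ k<y)

    lower : Chain c (λ x → 1 ≤ x × x ≤ k)
    lower = record
      { elements = D₂ ++ 1 ∷ U₁
      ; arc      = Linked-join D₂ (Linked-++⁻ʳ (suc n ∷ D₁) descent-arc′) (Linked-++⁻ˡ (1 ∷ U₁) ascent-arc′)
      ; sound    = sound
      ; complete = complete
      }
      where
      sound : ∀ {x} → x ∈ D₂ ++ 1 ∷ U₁ → 1 ≤ x × x ≤ k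
      sound x∈ with ∈-++⁻ D₂ x∈
      ... | inj₁ x∈D₂         =
        proj₁ (cycle-∈⁻ (from-descent (∈-++⁺ʳ D₁ x∈D₂))) , ≮⇒≥ (All.lookup D₂≤k x∈D₂)
      ... | inj₂ (here refl)  = ≤-refl , 1≤k
      ... | inj₂ (there x∈U₁) =
        proj₁ (cycle-∈⁻ (from-ascent (∈-++⁺ˡ x∈U₁))) , All.lookup U₁≤k x∈U₁
      complete : ∀ {x} → 1 ≤ x × x ≤ k → x ∈ D₂ ++ 1 ∷ U₁
      complete (1≤x , x≤k) with region (cycle-∈⁺ 1≤x (≤-trans x≤k (m≤n⇒m≤1+n k≤n)))
      ... | bottom refl       = ∈-++⁺ʳ D₂ (here refl)
      ... | low-ascent x∈U₁   = ∈-++⁺ʳ D₂ (there x∈U₁)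
      ... | high-ascent x∈U₂  = ⊥-elim (All.lookup U₂>k x∈U₂ x≤k)
      ... | top refl          = ⊥-elim (<⇒≱ (s≤s k≤n) x≤k)
      ... | high-descent x∈D₁ = ⊥-elim (<⇒≱ (All.lookup D₁>k x∈D₁) x≤k)
      ... | low-descent x∈D₂  = ∈-++⁺ˡ x∈D₂

-- Young diagrams and the labels ℓ_i, r_j

Fer-∈⁻ : ∀ la {i j} → (i , j) ∈ Fer la → (1 ≤ i × i ≤ length la) × (1 ≤ j × j ≤ part la i)
Fer-∈⁻ la b∈
  with i , i∈ , b∈row ← find (∈-concatMap⁻ (λ i → map (i ,_) (oneTo (part la i))) {xs = oneTo (length la)} b∈)
  with j , j∈ , refl ← ∈-map⁻ (i ,_) b∈row
  = oneTo-∈⁻ i∈ , oneTo-∈⁻ j∈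

Fer-∈⁺ : ∀ la {i j} → 1 ≤ i → i ≤ length la → 1 ≤ j → j ≤ part la i → (i , j) ∈ Fer la
Fer-∈⁺ la {i} {j} 1≤i i≤ℓ 1≤j j≤λᵢ = ∈-concatMap⁺ (λ i → map (i ,_) (oneTo (part la i)))
  (Any.map (λ { refl → ∈-map⁺ (i ,_) (oneTo-∈⁺ 1≤j j≤λᵢ) }) (oneTo-∈⁺ {length la} 1≤i i≤ℓ))

partition-tail : ∀ {x xs} → IsPartition (x ∷ xs) → IsPartition xs
partition-tail (desc , pos) = Linked.tail desc , All.tail pos

partition-bounded : ∀ {x xs} → IsPartition (x ∷ xs) → All (_≤ x) xs
partition-bounded {xs = []}     _            = []
partition-bounded {xs = y ∷ ys} p@(y≤x ∷ _ , _) =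
  y≤x ∷ All.map (λ z≤y → ≤-trans z≤y y≤x) (partition-bounded (partition-tail p))

part-step : ∀ {la} → IsPartition la → ∀ i → part la (suc (suc i)) ≤ part la (suc i)
part-step {[]}          _ i       = z≤n
part-step {x ∷ []}      _ zero    = z≤n
part-step {x ∷ y ∷ ys}  (y≤x ∷ _ , _) zero = y≤x
part-step {x ∷ xs}      p (suc i) = part-step (partition-tail p) i

part-antitone : ∀ {la} → IsPartition la → ∀ {i i′} → 1 ≤ i → i ≤ i′ → part la i′ ≤ part la i
part-antitone p {suc _} {zero} _ ()
part-antitone {la} p {i} {suc i″} 1≤i i≤i′ with m≤n⇒m<n∨m≡n i≤i′
... | inj₂ refl       = ≤-refl
... | inj₁ (s≤s i≤i″) = ≤-trans (part-pred i″ (≤-trans 1≤i i≤i″)) (part-antitone p 1≤i i≤i″)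
  where
  part-pred : ∀ m → 1 ≤ m → part la (suc m) ≤ part la m
  part-pred (suc m) _ = part-step p m

part-positive⇒≤length : ∀ la {i} → 1 ≤ part la i → i ≤ length la
part-positive⇒≤length (x ∷ xs) {zero}          _ = z≤n
part-positive⇒≤length (x ∷ xs) {suc zero}      _ = s≤s z≤n
part-positive⇒≤length (x ∷ xs) {suc (suc i)} pos = s≤s (part-positive⇒≤length xs pos)

conjPart-≤-length : ∀ la j → conjPart la j ≤ length la
conjPart-≤-length la j = length-filter (j ≤?_) la

≤part⇒≤conjPart : ∀ {la} → IsPartition la → ∀ {i j} → 1 ≤ i → 1 ≤ j →
                  j ≤ part la i → i ≤ conjPart la j
≤part⇒≤conjPart {[]}     p _ 1≤j j≤0 = ⊥-elim (<⇒≱ 1≤j j≤0)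
≤part⇒≤conjPart {x ∷ xs} p {suc zero}    {j} _ _   j≤x rewrite filter-accept (j ≤?_) {x} {xs} j≤x = s≤s z≤n
≤part⇒≤conjPart {x ∷ xs} p {suc (suc i)} {j} _ 1≤j j≤λᵢ
  rewrite filter-accept (j ≤?_) {x} {xs} (≤-trans j≤λᵢ (part-antitone p {1} {suc (suc i)} (s≤s z≤n) (s≤s z≤n)))
  = s≤s (≤part⇒≤conjPart (partition-tail p) (s≤s z≤n) 1≤j j≤λᵢ)

≤conjPart⇒≤part : ∀ {la} → IsPartition la → ∀ {i j} → 1 ≤ i → i ≤ conjPart la j → j ≤ part la i
≤conjPart⇒≤part {[]}     p 1≤i i≤0 = ⊥-elim (<⇒≱ 1≤i i≤0)
≤conjPart⇒≤part {x ∷ xs} p {i} {j} 1≤i i≤λ′ⱼ with j ≤? x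
≤conjPart⇒≤part {x ∷ xs} p {suc zero} 1≤i i≤λ′ⱼ | yes j≤x = j≤x
≤conjPart⇒≤part {x ∷ xs} p {suc (suc i)} {j} 1≤i i≤λ′ⱼ | yes j≤x
  rewrite filter-accept (j ≤?_) {x} {xs} j≤x
  = ≤conjPart⇒≤part (partition-tail p) (s≤s z≤n) (≤-pred i≤λ′ⱼ)
≤conjPart⇒≤part {x ∷ xs} p {i} {j} 1≤i i≤λ′ⱼ | no j≰x
  rewrite filter-reject (j ≤?_) {x} {xs} j≰x
        | filter-none (j ≤?_) (All.map (λ y≤x j≤y → j≰x (≤-trans j≤y y≤x)) (partition-bounded p))
  = ⊥-elim (<⇒≱ 1≤i i≤λ′ⱼ)

_≼_ : ℕ × ℕ → ℕ × ℕ → Set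
(i , j) ≼ (i₀ , j₀) = i ≤ i₀ × j ≤ j₀

m∸n≤o⇒m≤o+n : ∀ m n {o} → m ∸ n ≤ o → m ≤ o + n
m∸n≤o⇒m≤o+n m n {o} m∸n≤o with n ≤? m
... | yes n≤m = subst (_≤ o + n) (m∸n+n≡m n≤m) (+-monoˡ-≤ n m∸n≤o)
... | no  n≰m = ≤-trans (<⇒≤ (≰⇒> n≰m)) (m≤n+m n o)

hook-nonempty : ∀ {la n} → IsPartition la → InHk n la → 1 ≤ length la × 1 ≤ first la
hook-nonempty {x ∷ _} (_ , 1≤x ∷ _) _ = s≤s z≤n , 1≤x

module Diagonal (la : List ℕ) (la-partition : IsPartition la) (n : ℕ) (hook : InHk n la)
                (k : ℕ) (1≤k : 1 ≤ k) (k≤n : k ≤ n) where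

  λ₁ : ℕ
  λ₁ = first la

  λ₁+1+ : ∀ x → λ₁ + 1 + x ≡ suc (λ₁ + x)
  λ₁+1+ x = trans (+-assoc λ₁ 1 x) (+-suc λ₁ x)

  lab-positive : ∀ {i} → 1 ≤ i → 1 ≤ lab la i
  lab-positive 1≤i = m<n⇒0<n∸m (≤-<-trans (part-antitone la-partition ≤-refl 1≤i) (m<m+n λ₁ 1≤i))

  rab-≤ : ∀ {j} → 1 ≤ j → rab la j ≤ suc n
  rab-≤ {j} 1≤j = begin
    (λ₁ + 1 + conjPart la j) ∸ j      ≤⟨ ∸-mono (+-monoʳ-≤ (λ₁ + 1) (conjPart-≤-length la j)) 1≤j ⟩
    (λ₁ + 1 + length la) ∸ 1          ≡⟨ cong (_∸ 1) (λ₁+1+ (length la)) ⟩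
    λ₁ + length la                    ≡⟨ hook ⟩
    suc n                             ∎
    where open ≤-Reasoning

  diagonal-∈⁻ : ∀ {i j} → (i , j) ∈ Diag la k → (i , j) ∈ Fer la × λ₁ + i ≡ k + j
  diagonal-∈⁻ b∈ = ∈-filter⁻ _ {xs = Fer la} b∈

  lab-≤-above-diagonal : ∀ {i i₀ j₀} → 1 ≤ i → i ≤ i₀ → j₀ ≤ part la i₀ → λ₁ + i₀ ≡ k + j₀ →
                         lab la i ≤ k
  lab-≤-above-diagonal {i} {i₀} {j₀} 1≤i i≤i₀ j₀≤λ diag = begin
    (λ₁ + i) ∸ part la i      ≤⟨ ∸-mono (+-monoʳ-≤ λ₁ i≤i₀)
                                          (≤-trans j₀≤λ (part-antitone la-partition 1≤i i≤i₀)) ⟩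
    (λ₁ + i₀) ∸ j₀            ≡⟨ cong (_∸ j₀) diag ⟩
    (k + j₀) ∸ j₀             ≡⟨ m+n∸n≡m k j₀ ⟩
    k                         ∎
    where open ≤-Reasoning

  rab->-left-of-diagonal : ∀ {j i₀ j₀} → 1 ≤ j → j ≤ j₀ → 1 ≤ i₀ → j₀ ≤ part la i₀ → λ₁ + i₀ ≡ k + j₀ →
                           k < rab la j
  rab->-left-of-diagonal {j} {i₀} {j₀} 1≤j j≤j₀ 1≤i₀ j₀≤λ diag = begin
    suc k                          ≡⟨ m+n∸n≡m (suc k) j₀ ⟨
    (suc k + j₀) ∸ j₀              ≡⟨ cong (_∸ j₀) (trans (λ₁+1+ i₀) (cong suc diag)) ⟨
    (λ₁ + 1 + i₀) ∸ j₀             ≤⟨ ∸-mono (+-monoʳ-≤ (λ₁ + 1) i₀≤λ′) j≤j₀ ⟩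
    (λ₁ + 1 + conjPart la j) ∸ j   ∎
    where
    open ≤-Reasoning
    i₀≤λ′ : i₀ ≤ conjPart la j
    i₀≤λ′ = ≤part⇒≤conjPart la-partition 1≤i₀ 1≤j (≤-trans j≤j₀ j₀≤λ)

  -- (i , j) lies left of the diagonal box in its row or above the one in its column
  dominating-diagonal-box : ∀ {i j} → (i , j) ∈ Fer la → lab la i ≤ k → k < rab la j →
                            ∃ λ b → b ∈ Diag la k × (i , j) ≼ b
  dominating-diagonal-box {i} {j} b∈ ℓᵢ≤k k<rⱼ with Fer-∈⁻ la b∈ | j + k ≤? λ₁ + i
  ... | (1≤i , i≤ℓ) , (1≤j , j≤λᵢ) | yes j+k≤λ₁+i =
    (i , j₀) , ∈-filter⁺ _ (Fer-∈⁺ la 1≤i i≤ℓ (≤-trans 1≤j j≤j₀) j₀≤λᵢ) diag , ≤-refl , j≤j₀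
    where
    j₀ : ℕ
    j₀ = (λ₁ + i) ∸ k
    j≤j₀ : j ≤ j₀
    j≤j₀ = m+n≤o⇒m≤o∸n j j+k≤λ₁+i
    j₀≤λᵢ : j₀ ≤ part la i
    j₀≤λᵢ = m≤n+o⇒m∸n≤o (λ₁ + i) k (m∸n≤o⇒m≤o+n (λ₁ + i) (part la i) ℓᵢ≤k)
    diag : λ₁ + i ≡ k + j₀
    diag = sym (m+[n∸m]≡n (m+n≤o⇒n≤o j j+k≤λ₁+i))
  ... | (1≤i , i≤ℓ) , (1≤j , j≤λᵢ) | no j+k≰λ₁+i =
    (i₀ , j) ,
    ∈-filter⁺ _ (Fer-∈⁺ la (≤-trans 1≤i i≤i₀) (part-positive⇒≤length la (≤-trans 1≤j j≤λᵢ₀)) 1≤j j≤λᵢ₀) diag ,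
    i≤i₀ , ≤-refl
    where
    λ₁+i≤j+k : λ₁ + i ≤ j + k
    λ₁+i≤j+k = <⇒≤ (≰⇒> j+k≰λ₁+i)
    i₀ : ℕ
    i₀ = (j + k) ∸ λ₁
    i≤i₀ : i ≤ i₀
    i≤i₀ = m+n≤o⇒m≤o∸n i (subst (_≤ j + k) (+-comm λ₁ i) λ₁+i≤j+k)
    diag : λ₁ + i₀ ≡ k + j
    diag = trans (m+[n∸m]≡n (m+n≤o⇒m≤o λ₁ λ₁+i≤j+k)) (+-comm j k)
    j≤λ₁+1+λ′ : j ≤ λ₁ + 1 + conjPart la j
    j≤λ₁+1+λ′ = ≤-trans (≤-trans j≤λᵢ (part-antitone la-partition ≤-refl 1≤i))
                        (≤-trans (m≤m+n λ₁ 1) (m≤m+n _ _))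
    j+k≤λ₁+λ′ : j + k ≤ λ₁ + conjPart la j
    j+k≤λ₁+λ′ = s≤s⁻¹ (subst₂ _≤_ (cong suc (+-comm k j)) (λ₁+1+ (conjPart la j))
                               (m≤o∸n⇒m+n≤o (suc k) j≤λ₁+1+λ′ k<rⱼ))
    j≤λᵢ₀ : j ≤ part la i₀
    j≤λᵢ₀ = ≤conjPart⇒≤part la-partition (≤-trans 1≤i i≤i₀) (m≤n+o⇒m∸n≤o (j + k) λ₁ j+k≤λ₁+λ′)

  square-∈⁻ : ∀ {b} → b ∈ Square la k → b ∈ Fer la × ∃ λ b₀ → b₀ ∈ Diag la k × b ≼ b₀
  square-∈⁻ {i , j} b∈ with b∈Fer , dominated ← ∈-filter⁻ _ {xs = Fer la} b∈
    with (i₀ , j₀) , b₀∈ , i≤i₀∧j≤j₀ ← find (any⁻ _ (Diag la k) dominated)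
    with i≤i₀ , j≤j₀ ← Equivalence.to T-∧ i≤i₀∧j≤j₀
    = b∈Fer , (i₀ , j₀) , b₀∈ , ≤ᵇ⇒≤ i i₀ i≤i₀ , ≤ᵇ⇒≤ j j₀ j≤j₀

  square-∈⁺ : ∀ {b b₀} → b ∈ Fer la → b₀ ∈ Diag la k → b ≼ b₀ → b ∈ Square la k
  square-∈⁺ b∈ b₀∈ (i≤i₀ , j≤j₀) =
    ∈-filter⁺ _ b∈ (any⁺ _ (Any.map (λ { refl → Equivalence.from T-∧ (≤⇒≤ᵇ i≤i₀ , ≤⇒≤ᵇ j≤j₀) })
                                    b₀∈))

  square-labels : ∀ {i j} → (i , j) ∈ Square la k →
                  (1 ≤ lab la i × lab la i ≤ k) × (k < rab la j × rab la j ≤ suc n)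
  square-labels b∈ with square-∈⁻ b∈
  ... | b∈Fer , _ , b₀∈ , i≤i₀ , j≤j₀ with Fer-∈⁻ la b∈Fer | diagonal-∈⁻ b₀∈
  ... | (1≤i , _) , (1≤j , _) | b₀∈Fer , diag with Fer-∈⁻ la b₀∈Fer
  ... | (1≤i₀ , _) , (_ , j₀≤λ) =
    (lab-positive 1≤i , lab-≤-above-diagonal 1≤i i≤i₀ j₀≤λ diag) ,
    (rab->-left-of-diagonal 1≤j j≤j₀ 1≤i₀ j₀≤λ diag , rab-≤ 1≤j)

  labels-square : ∀ {i j} → (i , j) ∈ Fer la → lab la i ≤ k → k < rab la j → (i , j) ∈ Square la k
  labels-square b∈ ℓᵢ≤k k<rⱼ with dominating-diagonal-box b∈ ℓᵢ≤k k<rⱼ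
  ... | _ , b₀∈ , b≼b₀ = square-∈⁺ b∈ b₀∈ b≼b₀

  conjPart-1 : conjPart la 1 ≡ length la
  conjPart-1 = cong length (filter-all (1 ≤?_) (proj₂ la-partition))

  rab-1 : rab la 1 ≡ suc n
  rab-1 = begin
    (λ₁ + 1 + conjPart la 1) ∸ 1   ≡⟨ cong (λ m → (λ₁ + 1 + m) ∸ 1) conjPart-1 ⟩
    (λ₁ + 1 + length la) ∸ 1       ≡⟨ cong (_∸ 1) (λ₁+1+ (length la)) ⟩
    λ₁ + length la                 ≡⟨ hook ⟩
    suc n                          ∎
    where open ≡-Reasoning

  some-diagonal-box : ∃ λ b → b ∈ Diag la k
  some-diagonal-box with 1≤ℓ , 1≤λ₁ ← hook-nonempty la-partition hook
    with b₀ , b₀∈ , _ ← dominating-diagonal-box (Fer-∈⁺ la ≤-refl 1≤ℓ ≤-refl 1≤λ₁)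
                          (≤-trans (≤-reflexive (m+n∸m≡n λ₁ 1)) 1≤k) (subst (k <_) (sym rab-1) (s≤s k≤n))
    = b₀ , b₀∈

  -- the lowest box of D_k(λ); all of □_k(λ) lies in the rectangle above and left of it
  corner : ℕ × ℕ
  corner = Extrema.argmax proj₁ (proj₁ some-diagonal-box) (Diag la k)

  height width : ℕ
  height = proj₁ corner
  width  = proj₂ corner

  corner-∈ : corner ∈ Diag la k
  corner-∈ = Extrema.argmax-all proj₁ (proj₂ some-diagonal-box) (All.tabulate (λ b∈ → b∈))

  diagonal-≼-corner : ∀ {b₀} → b₀ ∈ Diag la k → b₀ ≼ corner
  diagonal-≼-corner {i₀ , j₀} b₀∈ =
    i₀≤h , +-cancelˡ-≤ k j₀ width
             (subst₂ _≤_ (proj₂ (diagonal-∈⁻ b₀∈)) (proj₂ (diagonal-∈⁻ corner-∈)) (+-monoʳ-≤ λ₁ i₀≤h))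
    where i₀≤h = All.lookup (Extrema.f[xs]≤f[argmax] (proj₁ some-diagonal-box) (Diag la k)) b₀∈

  square-≼-corner : ∀ {b} → b ∈ Square la k → b ≼ corner
  square-≼-corner b∈
    with _ , _ , b₀∈ , i≤i₀ , j≤j₀ ← square-∈⁻ b∈
    with i₀≤h , j₀≤w ← diagonal-≼-corner b₀∈
    = ≤-trans i≤i₀ i₀≤h , ≤-trans j≤j₀ j₀≤w

  corner-Fer : (1 ≤ height × height ≤ length la) × (1 ≤ width × width ≤ part la height)
  corner-Fer = Fer-∈⁻ la (proj₁ (diagonal-∈⁻ corner-∈))

  row-labels : ∀ {t} → 1 ≤ t → t ≤ height → 1 ≤ lab la t × lab la t ≤ k
  row-labels 1≤t t≤h = lab-positive 1≤t ,
    lab-≤-above-diagonal 1≤t t≤h (proj₂ (proj₂ corner-Fer)) (proj₂ (diagonal-∈⁻ corner-∈))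

  column-labels : ∀ {t} → 1 ≤ t → t ≤ width → k < rab la t × rab la t ≤ suc n
  column-labels 1≤t t≤w =
    rab->-left-of-diagonal 1≤t t≤w (proj₁ (proj₁ corner-Fer)) (proj₂ (proj₂ corner-Fer))
                           (proj₂ (diagonal-∈⁻ corner-∈)) ,
    rab-≤ 1≤t

  corner-≤-delta : height ⊓ width ≤ delta la k
  corner-≤-delta = foldr-⊔-upper (∈-map⁺ _ corner-∈)

-- The graph AR^[k](c) weighted by a filling

-- unlike ≡-dec, its decisions compute, so weightAR la f is literally a weightAt
_≟ᵥ_ : DecidableEquality Vtx
(a , b) ≟ᵥ (a′ , b′) =
  map′ (uncurry (cong₂ _,_)) (λ e → cong proj₁ e , cong proj₂ e) ((a ≟ a′) ×-dec (b ≟ b′))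

module ARGraph (n : ℕ) (la : List ℕ) (la-partition : IsPartition la) (hook : InHk n la)
               {c : ℕ → ℕ} (unimodal : UnimodalCycle n c) (f : ℕ → ℕ → ℕ)
               (k : ℕ) (1≤k : 1 ≤ k) (k≤n : k ≤ n) where

  open Arcs unimodal
  open Threshold k 1≤k k≤n
  open Diagonal la la-partition n hook k 1≤k k≤n

  V : Vtx → Set
  V = ARVtx n k

  E : Vtx → Vtx → Set
  E = AREdge c

  V? : ∀ v → Dec (V v)
  V? (i , j) = ((1 ≤? i) ×-dec (i <? j) ×-dec (j ≤? suc n)) ×-dec (i ≤? k) ×-dec (k <? j)

  E? : ∀ v w → Dec (E v w)
  E? (i , j) (i′ , j′) =
    ((i′ ≟ i) ×-dec (j′ ≟ c j) ×-dec (i <? c j)) ⊎-dec ((i′ ≟ c i) ×-dec (j′ ≟ j) ×-dec (c i <? j))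

  vertices : List Vtx
  vertices = cartesianProduct (oneTo (suc n)) (oneTo (suc n))

  vertices-complete : ∀ {v} → V v → v ∈ vertices
  vertices-complete ((1≤i , i<j , j≤n) , i≤k , _) =
    ∈-cartesianProduct⁺ (oneTo-∈⁺ 1≤i (≤-trans i≤k (m≤n⇒m≤1+n k≤n)))
                        (oneTo-∈⁺ (≤-trans (s≤s z≤n) i<j) j≤n)

  -- along an edge i never wraps around to n + 1 (c i ≤ k) and j never to 1 (c j > i ≥ 1)
  Φ : Vtx → ℕ
  Φ (i , j) = position cycle-from-top i + position cycle-from-1 j

  Φ-increasing : ∀ {v w} → V v → E v w → V w → Φ v < Φ w
  Φ-increasing {i , j} ((1≤i , i<j , j≤n) , _) (inj₁ (refl , refl , i<cj)) _ =
    +-monoʳ-< (position cycle-from-top i)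
      (position-step-from-1 (≤-trans (s≤s z≤n) i<j) j≤n
        (λ cj≡1 → <⇒≱ i<cj (subst (_≤ i) (sym cj≡1) 1≤i)))
  Φ-increasing {i , j} ((1≤i , i<j , _) , i≤k , _) (inj₂ (refl , refl , ci<j)) (_ , ci≤k , _) =
    +-monoˡ-< (position cycle-from-1 j)
      (position-step-from-top 1≤i (≤-trans i≤k (m≤n⇒m≤1+n k≤n))
        (λ ci≡top → <⇒≱ (s≤s k≤n) (subst (_≤ k) ci≡top ci≤k)))

  open FiniteMaxima V? E? vertices vertices-complete Φ Φ-increasing
  open Maxima (weightAR la f) {k , suc k} ((1≤k , ≤-refl , s≤s k≤n) , ≤-refl , ≤-refl) public

  labelOf : ℕ × ℕ → Vtx
  labelOf (i , j) = lab la i , rab la j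

  open Indicators _≟ᵥ_ labelOf (uncurry f)
  open import Data.List.Membership.DecPropositional _≟ᵥ_ using () renaming (_∈?_ to _∈ᵥ?_)

  support : ∀ {m} → Vec (List Vtx) m → List Vtx
  support ps = deduplicate (≡-dec _≟_ _≟_) (concat (toList ps))

  unionWeight≡weightIn : ∀ {m} (ps : Vec (List Vtx) m) → unionWeight (weightAR la f) ps ≡ weightIn (Fer la) (support ps)
  unionWeight≡weightIn ps = sum-weightAt (Fer la) (UniqueDec.deduplicate-! (≡-dec _≟_ _≟_) (concat (toList ps)))

  squareWeight : ℕ
  squareWeight = sumOver f (Square la k)

  unionWeight-≤-squareWeight : ∀ {m} (ps : Vec (List Vtx) m) → VA.All (IsPath V E) ps →
                               unionWeight (weightAR la f) ps ≤ squareWeight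
  unionWeight-≤-squareWeight ps ps-paths = begin
    unionWeight (weightAR la f) ps   ≡⟨ unionWeight≡weightIn ps ⟩
    weightIn (Fer la) (support ps)   ≤⟨ sum-map-≤-filter _ _ (uncurry f) (Fer la) (λ _ _ → indicator-≤)
                                          (λ x∈ x∉□ → outside x∈ (x∉□ ∘ proj₂ ∘ ∈-filter⁻ _ {xs = Fer la})) ⟩
    squareWeight                     ∎
    where
    open ≤-Reasoning
    indicator-≤ : ∀ {b w} → (if b then w else 0) ≤ w
    indicator-≤ {true}  = ≤-refl
    indicator-≤ {false} = z≤n
    outside : ∀ {x} → x ∈ Fer la → x ∉ Square la k →
              (if does (labelOf x ∈ᵥ? support ps) then uncurry f x else 0) ≡ 0
    outside {x} x∈ x∉□ with labelOf x ∈ᵥ? support ps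
    ... | no _   = refl
    ... | yes ℓ∈ with _ , (ℓᵢ≤k , k<rⱼ) ← tuple-vertices ps-paths (∈-deduplicate⁻ (≡-dec _≟_ _≟_) _ ℓ∈)
      = ⊥-elim (x∉□ (labels-square x∈ ℓᵢ≤k k<rⱼ))

  in-AR : ∀ {i j} → 1 ≤ i × i ≤ k → k < j × j ≤ suc n → V (i , j)
  in-AR (1≤i , i≤k) (k<j , j≤n) = (1≤i , ≤-<-trans i≤k k<j , j≤n) , i≤k , k<j

  row-path : ∀ {i} → 1 ≤ i × i ≤ k → ∀ js {z} → z ∈ js → IsArc c js →
             (∀ {j} → j ∈ js → k < j × j ≤ suc n) → IsPath V E (map (i ,_) js)
  row-path i-ok (j ∷ [])      _ _       j-ok = single (in-AR i-ok (j-ok (here refl)))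
  row-path {i} i-ok (j ∷ j′ ∷ js) _ (cj≡j′ ∷ l) j-ok =
    step (in-AR i-ok (j-ok (here refl))) (inj₁ (refl , sym cj≡j′ , i<cj)) (row-path i-ok (j′ ∷ js) (here refl) l (j-ok ∘ there))
    where
    i<cj : i < c j
    i<cj = subst (i <_) (sym cj≡j′) (≤-<-trans (proj₂ i-ok) (proj₁ (j-ok (there (here refl)))))

  column-path : ∀ {j} → k < j × j ≤ suc n → ∀ is {z} → z ∈ is → IsArc c is →
                (∀ {i} → i ∈ is → 1 ≤ i × i ≤ k) → IsPath V E (map (_, j) is)
  column-path j-ok (i ∷ [])      _ _       i-ok = single (in-AR (i-ok (here refl)) j-ok)
  column-path {j} j-ok (i ∷ i′ ∷ is) _ (ci≡i′ ∷ l) i-ok =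
    step (in-AR (i-ok (here refl)) j-ok) (inj₂ (sym ci≡i′ , refl , ci<j)) (column-path j-ok (i′ ∷ is) (here refl) l (i-ok ∘ there))
    where
    ci<j : c i < j
    ci<j = subst (_< j) (sym ci≡i′) (≤-<-trans (proj₂ (i-ok (there (here refl)))) (proj₁ j-ok))

  length-map-oneTo : ∀ {g : ℕ → List Vtx} m → length (map g (oneTo m)) ≡ m
  length-map-oneTo {g} m = trans (length-map g (oneTo m)) (length-applyUpTo suc m)

  Cover : Set
  Cover = Σ (List (List Vtx)) λ ps → All (IsPath V E) ps × length ps ≤ delta la k ×
                                     (∀ {b} → b ∈ Square la k → labelOf b ∈ concat ps)

  -- the rows or the columns of the rectangle containing □_k(λ), whichever are fewer
  cover : Cover
  cover with height ≤? width
  ... | yes h≤w = rows , All.tabulate row-paths , length-≤ , covers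
    where
    open Chain upper
    rows : List (List Vtx)
    rows = map (λ t → map (lab la t ,_) elements) (oneTo height)
    row-paths : ∀ {p} → p ∈ rows → IsPath V E p
    row-paths p∈ with t , t∈ , refl ← ∈-map⁻ _ p∈ with 1≤t , t≤h ← oneTo-∈⁻ t∈ =
      row-path (row-labels 1≤t t≤h) elements (complete (s≤s k≤n , ≤-refl)) arc sound
    length-≤ : length rows ≤ delta la k
    length-≤ = subst (_≤ delta la k) (trans (m≤n⇒m⊓n≡m h≤w) (sym (length-map-oneTo height))) corner-≤-delta
    covers : ∀ {b} → b ∈ Square la k → labelOf b ∈ concat rows
    covers {i , j} b∈ with (1≤i , _) , _ ← Fer-∈⁻ la (proj₁ (square-∈⁻ b∈)) =
      ∈-concat⁺′ (∈-map⁺ (lab la i ,_) (complete (proj₂ (square-labels b∈))))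
                 (∈-map⁺ _ (oneTo-∈⁺ 1≤i (proj₁ (square-≼-corner b∈))))
  ... | no h≰w = columns , All.tabulate column-paths , length-≤ , covers
    where
    open Chain lower
    columns : List (List Vtx)
    columns = map (λ t → map (_, rab la t) elements) (oneTo width)
    column-paths : ∀ {p} → p ∈ columns → IsPath V E p
    column-paths p∈ with t , t∈ , refl ← ∈-map⁻ _ p∈ with 1≤t , t≤w ← oneTo-∈⁻ t∈ =
      column-path (column-labels 1≤t t≤w) elements (complete (≤-refl , 1≤k)) arc sound
    length-≤ : length columns ≤ delta la k
    length-≤ = subst (_≤ delta la k) (trans (m≥n⇒m⊓n≡n (<⇒≤ (≰⇒> h≰w))) (sym (length-map-oneTo width))) corner-≤-delta
    covers : ∀ {b} → b ∈ Square la k → labelOf b ∈ concat columns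
    covers {i , j} b∈ with _ , (1≤j , _) ← Fer-∈⁻ la (proj₁ (square-∈⁻ b∈)) =
      ∈-concat⁺′ (∈-map⁺ (_, rab la j) (complete (proj₁ (square-labels b∈))))
                 (∈-map⁺ _ (oneTo-∈⁺ 1≤j (proj₂ (square-≼-corner b∈))))

  squareWeight-≤-M : squareWeight ≤ M (delta la k)
  squareWeight-≤-M with ps , ps-paths , length-≤ , covers ← cover = begin
    squareWeight                                ≤⟨ sum-map-filter-≤ _ _ (uncurry f) (Fer la)
                                                     (λ x∈ px → inside x∈ (∈-filter⁺ _ x∈ px)) ⟩
    weightIn (Fer la) (support (fromList ps))   ≡⟨ unionWeight≡weightIn (fromList ps) ⟨
    unionWeight (weightAR la f) (fromList ps)   ≤⟨ M-maximal (fromList ps) (VA.fromList⁺ ps-paths) ⟩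
    M (length ps)                               ≤⟨ M-mono-≤ length-≤ ⟩
    M (delta la k)                              ∎
    where
    open ≤-Reasoning
    inside : ∀ {x} → x ∈ Fer la → x ∈ Square la k →
             uncurry f x ≤ (if does (labelOf x ∈ᵥ? support (fromList ps)) then uncurry f x else 0)
    inside {x} x∈ x∈□ with labelOf x ∈ᵥ? support (fromList ps)
    ... | yes _ = ≤-refl
    ... | no ℓ∉ = ⊥-elim (ℓ∉ (∈-deduplicate⁺ (≡-dec _≟_ _≟_)
                    (subst (λ qs → labelOf x ∈ concat qs) (sym (toList∘fromList ps)) (covers x∈□))))

  M-delta : M (delta la k) ≡ squareWeight
  M-delta = ≤-antisym (unionWeight-≤-squareWeight (best (delta la k)) (best-paths (delta la k))) squareWeight-≤-M

lemma6p8 : (n : ℕ) → 1 ≤ n → (la : List ℕ) → IsPartition la → InHk n la →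
    (σ : List ℕ) → σ ↭ oneTo n →
    (f : ℕ → ℕ → ℕ) → (k : ℕ) → 1 ≤ k → k ≤ n →
    Σ (ℕ → ℕ) (λ M →
      IsMaxSeq (ARVtx n k) (AREdge (coxeter σ)) (weightAR la f) M
      × sumFrom1 (delta la k) (RSKval M) ≡ sumOver f (Square la k))
lemma6p8 (suc n) _ la la-partition hook σ σ↭ f k 1≤k k≤n =
  M , M-isMaxSeq , trans (sumFrom1-RSK (delta la k)) M-delta
  where open ARGraph (suc n) la la-partition hook (coxeter-unimodal n σ↭) f k 1≤k k≤n
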